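{- Let $k\ge2$ and $T\ge3$ be integers, and let $a_1,\dots,a_k$ and $b_1,\dots,b_k$ be positive integers. Set $\Delta=\sum_{i=1}^k a_ib_i$ and $N=\sum_{1\le i\le j\le k}a_ib_j$. If $a_1=b_k=1$ and $a_ib_i\le T$ for all $1\le i\le k$, then \[ \Delta\le\sqrt{32\,N\,T\ln T}. \] -}

module Defs where

open import Data.Nat using (ℕ; _+_; _*_; _^_; _≤_; _≤ᵇ_)
open import Data.Nat using (_!)
open import Data.Fin using (Fin; toℕ; zero; suc)
open import Data.Bool using (if_then_else_)

sumFin : ∀ {n} → (Fin n → ℕ) → ℕ
sumFin {ℕ.zero}  f = 0
sumFin {ℕ.suc n} f = f zero + sumFin (λ i → f (suc i))

Delta : ∀ {k} → (Fin k → ℕ) → (Fin k → ℕ) → ℕ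
Delta a b = sumFin (λ i → a i * b i)

Nsum : ∀ {k} → (Fin k → ℕ) → (Fin k → ℕ) → ℕ
Nsum a b = sumFin (λ i → sumFin (λ j →
  if toℕ i ≤ᵇ toℕ j then a i * b j else 0))

-- expScaled m K = K! * Σ_{j=0}^{K} m^j / j!   (a natural number),
-- via S 0 = 1, S (K+1) = (K+1) * S K + m^(K+1).
expScaled : ℕ → ℕ → ℕ
expScaled m ℕ.zero    = 1
expScaled m (ℕ.suc K) = ℕ.suc K * expScaled m K + m ^ ℕ.suc K

-- e^m ≤ x   (x a natural number), stated exactly via partial sums of the
-- exponential series:  e^m = sup_K Σ_{j≤K} m^j/j!.
ExpLe : ℕ → ℕ → Set
ExpLe m x = ∀ K → expScaled m K ≤ (K !) * x

-- Δ ≤ √(32 N T ln T)  ⇔  Δ² ≤ 32 N T ln T  ⇔  e^(Δ²) ≤ T^(32 N T)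
SqrtLogBound : (Δ N T : ℕ) → Set
SqrtLogBound Δ N T = ExpLe (Δ * Δ) (T ^ (32 * N * T))

-- Sort the indices into dyadic classes by ⌊log₂ aᵢ⌋; since aᵢ ≤ aᵢbᵢ ≤ T there are at most
-- 1 + ⌊log₂ T⌋ of them. Inside a class aⱼ < 2aᵢ, so for i ≤ j the product cᵢcⱼ of the
-- diagonal terms cᵢ = aᵢbᵢ is at most T·aⱼbⱼ ≤ 2T·aᵢbⱼ, a term of N. Summing over pairs, the
-- square of a class sum of the cᵢ is at most 4T times that class's share of N, and
-- Cauchy–Schwarz over the classes gives Δ² ≤ 4(1 + ⌊log₂ T⌋)TN ≤ 8TN log₂ T. As e ≤ 16,
-- e^(Δ²) ≤ 16^(Δ²) ≤ 2^(32 TN log₂ T) ≤ T^(32NT).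
module Submission where

open import Data.Bool using (true; false; if_then_else_)
open import Data.Bool.Properties using (T-≡; if-cong)
open import Data.Fin using (Fin; toℕ; zero; suc; fromℕ<; _≟_)
open import Data.Fin.Properties using (toℕ-fromℕ<)
open import Data.Nat
  using ( ℕ; zero; suc; _+_; _∸_; _*_; _^_; _≤_; _<_; _≤ᵇ_; _!; ⌊_/2⌋; ⌈_/2⌉; z≤n; s≤s
        ; NonZero; >-nonZero)
open import Data.Nat.Logarithm using (⌊log₂_⌋; ⌊log₂⌋-mono-≤; ⌊log₂[2*b]⌋≡1+⌊log₂b⌋)
open import Data.Nat.Logarithm.Core using (⌊log2⌋)
open import Data.Nat.Properties hiding (_≟_)
open import Algebra.Properties.Semiring.Sum +-*-semiring
  using ( sum; sum-syntax; sum-cong-≗; sum-replicate-zero; ∑-comm; ∑-distrib-+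
        ; *-distribˡ-sum; *-distribʳ-sum)
open import Data.Nat.Tactic.RingSolver using (solve-∀)
open import Data.Sum using (_⊎_; inj₁; inj₂)
open import Function using (_$_; Equivalence)
open import Induction.WellFounded using (Acc; acc)
open import Relation.Binary.PropositionalEquality
  using (_≡_; refl; sym; trans; cong; cong₂; subst; subst₂)
open import Relation.Nullary using (Dec; does; yes; no)

open import Defs

open Equivalence using (to)

sumFin≡sum : ∀ {n} (f : Fin n → ℕ) → sumFin f ≡ sum f
sumFin≡sum {zero}  f = refl
sumFin≡sum {suc n} f = cong (f zero +_) (sumFin≡sum (λ i → f (suc i)))

sum-mono-≤ : ∀ {n} {f g : Fin n → ℕ} → (∀ i → f i ≤ g i) → sum f ≤ sum g
sum-mono-≤ {zero}  f≤g = z≤n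
sum-mono-≤ {suc n} f≤g = +-mono-≤ (f≤g zero) (sum-mono-≤ (λ i → f≤g (suc i)))

sum-const : ∀ n x → ∑[ i < n ] x ≡ n * x
sum-const zero    x = refl
sum-const (suc n) x = cong (x +_) (sum-const n x)

sum*sum : ∀ {m n} (f : Fin m → ℕ) (g : Fin n → ℕ) →
          sum f * sum g ≡ ∑[ i < m ] ∑[ j < n ] (f i * g j)
sum*sum f g = trans (*-distribʳ-sum (sum g) f) (sum-cong-≗ λ i → *-distribˡ-sum (f i) g)

m≤n⇒2*[m*n]≤m*m+n*n : ∀ {m n} → m ≤ n → 2 * (m * n) ≤ m * m + n * n
m≤n⇒2*[m*n]≤m*m+n*n {m} {n} m≤n =
  subst (λ n → 2 * (m * n) ≤ m * m + n * n) (m+[n∸m]≡n m≤n)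
        (≤-trans (m≤m+n _ (d * d)) (≤-reflexive (completed-square m d)))
  where
  d : ℕ
  d = n ∸ m
  completed-square : ∀ m d → 2 * (m * (m + d)) + d * d ≡ m * m + (m + d) * (m + d)
  completed-square = solve-∀

2*[m*n]≤m*m+n*n : ∀ m n → 2 * (m * n) ≤ m * m + n * n
2*[m*n]≤m*m+n*n m n with ≤-total m n
... | inj₁ m≤n = m≤n⇒2*[m*n]≤m*m+n*n m≤n
... | inj₂ n≤m = subst₂ _≤_ (cong (2 *_) (*-comm n m)) (+-comm (n * n) (m * m))
                            (m≤n⇒2*[m*n]≤m*m+n*n n≤m)

square-of-sum≤∑∑ : ∀ {n} (c : Fin n → ℕ) (y : Fin n → Fin n → ℕ) →
                   (∀ i j → 2 * (c i * c j) ≤ y i j + y j i) →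
                   sum c * sum c ≤ ∑[ i < n ] ∑[ j < n ] y i j
square-of-sum≤∑∑ {n} c y 2cc≤y+yᵀ = *-cancelˡ-≤ 2 $ begin
  2 * (sum c * sum c)                      ≡⟨ cong (2 *_) (sum*sum c c) ⟩
  2 * ∑[ i < n ] ∑[ j < n ] (c i * c j)   ≡⟨ *-distribˡ-sum 2 (λ i → ∑[ j < n ] (c i * c j)) ⟩
  ∑[ i < n ] (2 * ∑[ j < n ] (c i * c j)) ≡⟨ sum-cong-≗ (λ i → *-distribˡ-sum 2 (λ j → c i * c j)) ⟩
  ∑[ i < n ] ∑[ j < n ] (2 * (c i * c j)) ≤⟨ sum-mono-≤ (λ i → sum-mono-≤ (2cc≤y+yᵀ i)) ⟩
  ∑[ i < n ] ∑[ j < n ] (y i j + y j i)   ≡⟨ sum-cong-≗ (λ i → ∑-distrib-+ (y i) (λ j → y j i)) ⟩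
  ∑[ i < n ] (row i + column i)            ≡⟨ ∑-distrib-+ row column ⟩
  Y + sum column                           ≡⟨ cong (Y +_) (∑-comm (λ i j → y j i)) ⟩
  Y + Y                                    ≡⟨ cong (Y +_) (+-identityʳ Y) ⟨
  2 * Y                                    ∎
  where
  open ≤-Reasoning
  row column : Fin n → ℕ
  row    i = ∑[ j < n ] y i j
  column i = ∑[ j < n ] y j i
  Y : ℕ
  Y = sum row

square-of-sum≤n*sum-of-squares : ∀ {n} (f : Fin n → ℕ) →
                                 sum f * sum f ≤ n * ∑[ i < n ] (f i * f i)
square-of-sum≤n*sum-of-squares {n} f = begin
  sum f * sum f                     ≤⟨ square-of-sum≤∑∑ f (λ i _ → f i * f i)
                                         (λ i j → 2*[m*n]≤m*m+n*n (f i) (f j)) ⟩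
  ∑[ i < n ] ∑[ j < n ] (f i * f i) ≡⟨ sum-cong-≗ (λ i → sum-const n (f i * f i)) ⟩
  ∑[ i < n ] (n * (f i * f i))      ≡⟨ *-distribˡ-sum n (λ i → f i * f i) ⟨
  n * ∑[ i < n ] (f i * f i)        ∎
  where open ≤-Reasoning

classPart : ∀ {k m} → (Fin k → Fin m) → Fin m → (Fin k → ℕ) → Fin k → ℕ
classPart κ s f i = if does (κ i ≟ s) then f i else 0

∑-if-≟ : ∀ {m} (t : Fin m) x → ∑[ s < m ] (if does (t ≟ s) then x else 0) ≡ x
∑-if-≟ {suc m} zero    x = trans (cong (x +_) (sum-replicate-zero m)) (+-identityʳ x)
∑-if-≟ {suc m} (suc t) x = ∑-if-≟ t x

sum-if : ∀ {n} b (f : Fin n → ℕ) → ∑[ j < n ] (if b then f j else 0) ≡ (if b then sum f else 0)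
sum-if     true  f = refl
sum-if {n} false f = sum-replicate-zero n

sum≡∑-classParts : ∀ {k m} (κ : Fin k → Fin m) (f : Fin k → ℕ) →
                   sum f ≡ ∑[ s < m ] sum (classPart κ s f)
sum≡∑-classParts κ f =
  trans (sum-cong-≗ (λ i → sym (∑-if-≟ (κ i) (f i)))) (∑-comm (λ i s → classPart κ s f i))

2*[x*y]≤u+v-restricted : ∀ {P Q : Set} (p : Dec P) (q : Dec Q) {x y u v : ℕ} →
  (P → Q → 2 * (x * y) ≤ u + v) →
  2 * ((if does p then x else 0) * (if does q then y else 0))
    ≤ (if does p then u else 0) + (if does q then v else 0)
2*[x*y]≤u+v-restricted (yes p) (yes q) h = h p q
2*[x*y]≤u+v-restricted (yes _) (no _) {x} _ = ≤-trans (≤-reflexive (cong (2 *_) (*-zeroʳ x))) z≤n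
2*[x*y]≤u+v-restricted (no _)  _          _ = z≤n

square-of-sum≤#classes*∑∑ : ∀ {k m} (κ : Fin k → Fin m) (c : Fin k → ℕ) (y : Fin k → Fin k → ℕ) →
                            (∀ i j → κ i ≡ κ j → 2 * (c i * c j) ≤ y i j + y j i) →
                            sum c * sum c ≤ m * ∑[ i < k ] ∑[ j < k ] y i j
square-of-sum≤#classes*∑∑ {k} {m} κ c y same-class⇒ = begin
  sum c * sum c                   ≡⟨ cong₂ _*_ (sum≡∑-classParts κ c) (sum≡∑-classParts κ c) ⟩
  sum S * sum S                   ≤⟨ square-of-sum≤n*sum-of-squares S ⟩
  m * ∑[ s < m ] (S s * S s)      ≤⟨ *-monoʳ-≤ m (sum-mono-≤ λ s →
                                       square-of-sum≤∑∑ (classPart κ s c) (yPart s) (pointwise s)) ⟩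
  m * ∑[ s < m ] ∑[ i < k ] ∑[ j < k ] yPart s i j
                                  ≡⟨ cong (m *_) (sum-cong-≗ λ s → sum-cong-≗ λ i →
                                       sum-if (does (κ i ≟ s)) (y i)) ⟩
  m * ∑[ s < m ] sum (classPart κ s row)
                                  ≡⟨ cong (m *_) (sum≡∑-classParts κ row) ⟨
  m * ∑[ i < k ] ∑[ j < k ] y i j ∎
  where
  open ≤-Reasoning
  S : Fin m → ℕ
  S s = sum (classPart κ s c)
  yPart : Fin m → Fin k → Fin k → ℕ
  yPart s i j = classPart κ s (λ i → y i j) i
  row : Fin k → ℕ
  row i = ∑[ j < k ] y i j
  pointwise : ∀ s i j → 2 * (classPart κ s c i * classPart κ s c j) ≤ yPart s i j + yPart s j i
  pointwise s i j = 2*[x*y]≤u+v-restricted (κ i ≟ s) (κ j ≟ s)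
                      (λ κᵢ≡s κⱼ≡s → same-class⇒ i j (trans κᵢ≡s (sym κⱼ≡s)))

-- Stated for the accessibility-indexed ⌊log2⌋ so that the recursion follows its definition.
2^⌊log2⌋≤n : ∀ n (rec : Acc _<_ (suc n)) → 2 ^ ⌊log2⌋ (suc n) rec ≤ suc n
2^⌊log2⌋≤n zero    _        = ≤-refl
2^⌊log2⌋≤n (suc n) (acc rs) = begin
  2 * 2 ^ ⌊log2⌋ (suc ⌊ n /2⌋) _ ≤⟨ *-monoʳ-≤ 2 (2^⌊log2⌋≤n ⌊ n /2⌋ _) ⟩
  2 * suc ⌊ n /2⌋                  ≡⟨ *-suc 2 ⌊ n /2⌋ ⟩
  2 + (⌊ n /2⌋ + (⌊ n /2⌋ + 0))    ≤⟨ +-monoʳ-≤ 2 (+-monoʳ-≤ ⌊ n /2⌋ ⌊n/2⌋+0≤⌈n/2⌉) ⟩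
  2 + (⌊ n /2⌋ + ⌈ n /2⌉)          ≡⟨ cong (2 +_) (⌊n/2⌋+⌈n/2⌉≡n n) ⟩
  2 + n                            ∎
  where
  open ≤-Reasoning
  ⌊n/2⌋+0≤⌈n/2⌉ : ⌊ n /2⌋ + 0 ≤ ⌈ n /2⌉
  ⌊n/2⌋+0≤⌈n/2⌉ = ≤-trans (≤-reflexive (+-identityʳ _)) (⌊n/2⌋≤⌈n/2⌉ n)

2^⌊log₂n⌋≤n : ∀ n .{{_ : NonZero n}} → 2 ^ ⌊log₂ n ⌋ ≤ n
2^⌊log₂n⌋≤n (suc n) = 2^⌊log2⌋≤n n _

⌊log₂m⌋≡⌊log₂n⌋⇒n<2*m : ∀ m n .{{_ : NonZero m}} → ⌊log₂ m ⌋ ≡ ⌊log₂ n ⌋ → n < 2 * m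
⌊log₂m⌋≡⌊log₂n⌋⇒n<2*m m n eq = ≰⇒> λ 2m≤n → 1+n≰n $ begin
  1 + ⌊log₂ m ⌋     ≡⟨ ⌊log₂[2*b]⌋≡1+⌊log₂b⌋ m ⟨
  ⌊log₂ (2 * m) ⌋   ≤⟨ ⌊log₂⌋-mono-≤ 2m≤n ⟩
  ⌊log₂ n ⌋         ≡⟨ eq ⟨
  ⌊log₂ m ⌋         ∎
  where open ≤-Reasoning

triangle : ∀ {k} (a b : Fin k → ℕ) → Fin k → Fin k → ℕ
triangle a b i j = if toℕ i ≤ᵇ toℕ j then a i * b j else 0

Nsum≡∑∑triangle : ∀ {k} (a b : Fin k → ℕ) → Nsum a b ≡ ∑[ i < k ] ∑[ j < k ] triangle a b i j
Nsum≡∑∑triangle a b =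
  trans (sumFin≡sum (λ i → sumFin (triangle a b i))) (sum-cong-≗ λ i → sumFin≡sum (triangle a b i))

triangle-total : ∀ {k} (a b : Fin k → ℕ) i j →
                 triangle a b i j ≡ a i * b j ⊎ triangle a b j i ≡ a j * b i
triangle-total a b i j with ≤-total (toℕ i) (toℕ j)
... | inj₁ i≤j = inj₁ (if-cong (to T-≡ (≤⇒≤ᵇ i≤j)))
... | inj₂ j≤i = inj₂ (if-cong (to T-≡ (≤⇒≤ᵇ j≤i)))

cross-term-bound : ∀ {T} a b a′ b′ → a * b ≤ T → a′ ≤ 2 * a →
                   2 * (a * b * (a′ * b′)) ≤ 4 * T * (a * b′)
cross-term-bound {T} a b a′ b′ ab≤T a′≤2a = begin
  2 * (a * b * (a′ * b′)) ≤⟨ *-monoʳ-≤ 2 (*-monoˡ-≤ (a′ * b′) ab≤T) ⟩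
  2 * (T * (a′ * b′))     ≤⟨ *-monoʳ-≤ 2 (*-monoʳ-≤ T (*-monoˡ-≤ b′ a′≤2a)) ⟩
  2 * (T * (2 * a * b′))  ≡⟨ regroup T a b′ ⟩
  4 * T * (a * b′)        ∎
  where
  open ≤-Reasoning
  regroup : ∀ T a b′ → 2 * (T * (2 * a * b′)) ≡ 4 * T * (a * b′)
  regroup = solve-∀

comparable-pair-bound : ∀ {k} T (a b : Fin k → ℕ) i j →
  a i * b i ≤ T → a j * b j ≤ T → a j ≤ 2 * a i → a i ≤ 2 * a j →
  2 * (a i * b i * (a j * b j)) ≤ 4 * T * triangle a b i j + 4 * T * triangle a b j i
comparable-pair-bound T a b i j cᵢ≤T cⱼ≤T aⱼ≤2aᵢ aᵢ≤2aⱼ with triangle-total a b i j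
... | inj₁ tᵢⱼ = begin
  2 * (a i * b i * (a j * b j)) ≤⟨ cross-term-bound (a i) (b i) (a j) (b j) cᵢ≤T aⱼ≤2aᵢ ⟩
  4 * T * (a i * b j)           ≡⟨ cong (4 * T *_) tᵢⱼ ⟨
  4 * T * triangle a b i j      ≤⟨ m≤m+n _ _ ⟩
  4 * T * triangle a b i j + 4 * T * triangle a b j i ∎
  where open ≤-Reasoning
... | inj₂ tⱼᵢ = begin
  2 * (a i * b i * (a j * b j)) ≡⟨ cong (2 *_) (*-comm (a i * b i) (a j * b j)) ⟩
  2 * (a j * b j * (a i * b i)) ≤⟨ cross-term-bound (a j) (b j) (a i) (b i) cⱼ≤T aᵢ≤2aⱼ ⟩
  4 * T * (a j * b i)           ≡⟨ cong (4 * T *_) tⱼᵢ ⟨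
  4 * T * triangle a b j i      ≤⟨ m≤n+m _ _ ⟩
  4 * T * triangle a b i j + 4 * T * triangle a b j i ∎
  where open ≤-Reasoning

Delta²≤[1+⌊log₂T⌋]*4TN : ∀ {k} T (a b : Fin k → ℕ) → (∀ i → 1 ≤ a i) → (∀ i → 1 ≤ b i) →
                         (∀ i → a i * b i ≤ T) →
                         Delta a b * Delta a b ≤ suc ⌊log₂ T ⌋ * (4 * T * Nsum a b)
Delta²≤[1+⌊log₂T⌋]*4TN {k} T a b 1≤a 1≤b ab≤T = begin
  Delta a b * Delta a b               ≡⟨ cong₂ _*_ (sumFin≡sum c) (sumFin≡sum c) ⟩
  sum c * sum c                       ≤⟨ square-of-sum≤#classes*∑∑ κ c y same-class⇒ ⟩
  suc L * ∑[ i < k ] ∑[ j < k ] y i j ≡⟨ cong (suc L *_) ∑∑y≡4TN ⟩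
  suc L * (4 * T * Nsum a b)          ∎
  where
  open ≤-Reasoning
  L : ℕ
  L = ⌊log₂ T ⌋
  c : Fin k → ℕ
  c i = a i * b i
  y : Fin k → Fin k → ℕ
  y i j = 4 * T * triangle a b i j
  a≤T : ∀ i → a i ≤ T
  a≤T i = ≤-trans (m≤m*n (a i) (b i) {{>-nonZero (1≤b i)}}) (ab≤T i)
  κ : Fin k → Fin (suc L)
  κ i = fromℕ< (s≤s (⌊log₂⌋-mono-≤ (a≤T i)))
  aⱼ<2aᵢ : ∀ i j → κ i ≡ κ j → a j < 2 * a i
  aⱼ<2aᵢ i j κᵢ≡κⱼ = ⌊log₂m⌋≡⌊log₂n⌋⇒n<2*m (a i) (a j) {{>-nonZero (1≤a i)}}
    (trans (sym (toℕ-fromℕ< _)) (trans (cong toℕ κᵢ≡κⱼ) (toℕ-fromℕ< _)))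
  same-class⇒ : ∀ i j → κ i ≡ κ j → 2 * (c i * c j) ≤ y i j + y j i
  same-class⇒ i j κᵢ≡κⱼ = comparable-pair-bound T a b i j (ab≤T i) (ab≤T j)
    (<⇒≤ (aⱼ<2aᵢ i j κᵢ≡κⱼ)) (<⇒≤ (aⱼ<2aᵢ j i (sym κᵢ≡κⱼ)))
  ∑∑y≡4TN : ∑[ i < k ] ∑[ j < k ] y i j ≡ 4 * T * Nsum a b
  ∑∑y≡4TN = begin-equality
    ∑[ i < k ] ∑[ j < k ] y i j               ≡⟨ sum-cong-≗ (λ i → *-distribˡ-sum (4 * T) (triangle a b i)) ⟨
    ∑[ i < k ] (4 * T * sum (triangle a b i)) ≡⟨ *-distribˡ-sum (4 * T) (λ i → sum (triangle a b i)) ⟨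
    4 * T * ∑[ i < k ] sum (triangle a b i)   ≡⟨ cong (4 * T *_) (Nsum≡∑∑triangle a b) ⟨
    4 * T * Nsum a b                          ∎

[1+x]^[1+j]≤x^[1+j]+[1+j]*[1+x]^j : ∀ x j → suc x ^ suc j ≤ x ^ suc j + suc j * suc x ^ j
[1+x]^[1+j]≤x^[1+j]+[1+j]*[1+x]^j x zero    = ≤-reflexive (expand x)
  where
  expand : ∀ x → suc x * 1 ≡ x * 1 + 1 * 1
  expand = solve-∀
[1+x]^[1+j]≤x^[1+j]+[1+j]*[1+x]^j x (suc j) = begin
  suc x * suc x ^ suc j                               ≤⟨ *-monoʳ-≤ (suc x)
                                                           ([1+x]^[1+j]≤x^[1+j]+[1+j]*[1+x]^j x j) ⟩
  suc x * (x ^ suc j + suc j * suc x ^ j)             ≡⟨ expand x (x ^ suc j) j (suc x ^ j) ⟩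
  x * x ^ suc j + (x ^ suc j + suc j * suc x ^ suc j) ≤⟨ +-monoʳ-≤ (x * x ^ suc j)
                                                           (+-monoˡ-≤ (suc j * suc x ^ suc j) x^[1+j]≤[1+x]^[1+j]) ⟩
  x * x ^ suc j + suc (suc j) * suc x ^ suc j         ∎
  where
  open ≤-Reasoning
  x^[1+j]≤[1+x]^[1+j] : x ^ suc j ≤ suc x ^ suc j
  x^[1+j]≤[1+x]^[1+j] = ^-monoˡ-≤ (suc j) (n≤1+n x)
  expand : ∀ x X j Y → suc x * (X + suc j * Y) ≡ x * X + (X + suc j * (suc x * Y))
  expand = solve-∀

-- x^j/j! is at most the lattice-path count (x+j−1 choose j) ≤ 2^(x+j−1), and the induction
-- below is Pascal's rule for that count.
pascal-step : ∀ x j → 2 * x ^ suc j ≤ suc j ! * 2 ^ (x + suc j) →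
              2 * suc x ^ j ≤ j ! * 2 ^ (suc x + j) →
              2 * suc x ^ suc j ≤ suc j ! * 2 ^ (suc x + suc j)
pascal-step x j left≤ down≤ = begin
  2 * suc x ^ suc j                             ≤⟨ *-monoʳ-≤ 2 ([1+x]^[1+j]≤x^[1+j]+[1+j]*[1+x]^j x j) ⟩
  2 * (x ^ suc j + suc j * suc x ^ j)           ≡⟨ distribute (x ^ suc j) j (suc x ^ j) ⟩
  2 * x ^ suc j + suc j * (2 * suc x ^ j)       ≤⟨ +-mono-≤ left≤ (*-monoʳ-≤ (suc j) down≤) ⟩
  suc j ! * P + suc j * (j ! * 2 ^ (suc x + j)) ≡⟨ cong (λ e → suc j ! * P + suc j * (j ! * 2 ^ e))
                                                       (+-suc x j) ⟨
  suc j ! * P + suc j * (j ! * P)               ≡⟨ collect j (j !) P ⟩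
  suc j ! * (2 * P)                             ∎
  where
  open ≤-Reasoning
  P : ℕ
  P = 2 ^ (x + suc j)
  distribute : ∀ X j Y → 2 * (X + suc j * Y) ≡ 2 * X + suc j * (2 * Y)
  distribute = solve-∀
  collect : ∀ j F P → suc j * F * P + suc j * (F * P) ≡ suc j * F * (2 * P)
  collect = solve-∀

2*[1+x]^j≤j!*2^[1+x+j] : ∀ x j → 2 * suc x ^ j ≤ j ! * 2 ^ (suc x + j)
2*[1+x]^j≤j!*2^[1+x+j] x       zero    = ≤-trans (*-monoʳ-≤ 2 (m^n>0 2 (x + 0))) (m≤m+n _ 0)
2*[1+x]^j≤j!*2^[1+x+j] zero    (suc j) = pascal-step 0 j z≤n (2*[1+x]^j≤j!*2^[1+x+j] 0 j)
2*[1+x]^j≤j!*2^[1+x+j] (suc x) (suc j) =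
  pascal-step (suc x) j (2*[1+x]^j≤j!*2^[1+x+j] x (suc j)) (2*[1+x]^j≤j!*2^[1+x+j] (suc x) j)

[m*n]^j≡m^j*n^j : ∀ m n j → (m * n) ^ j ≡ m ^ j * n ^ j
[m*n]^j≡m^j*n^j m n zero    = refl
[m*n]^j≡m^j*n^j m n (suc j) =
  trans (cong (m * n *_) ([m*n]^j≡m^j*n^j m n j)) ([m*n]*[o*p]≡[m*o]*[n*p] m n (m ^ j) (n ^ j))

2^[1+j]*m^j≤j!*16^m : ∀ m j .{{_ : NonZero m}} → 2 ^ suc j * m ^ j ≤ j ! * 16 ^ m
2^[1+j]*m^j≤j!*16^m m@(suc m′) j = *-cancelˡ-≤ (2 ^ j) {{m^n≢0 2 j}} $ begin
  2 ^ j * (2 * 2 ^ j * m ^ j)  ≡⟨ regroup (2 ^ j) (m ^ j) ⟩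
  2 * (2 ^ j * 2 ^ j * m ^ j)  ≡⟨ cong (λ z → 2 * (z * m ^ j)) ([m*n]^j≡m^j*n^j 2 2 j) ⟨
  2 * (4 ^ j * m ^ j)          ≡⟨ cong (2 *_) ([m*n]^j≡m^j*n^j 4 m j) ⟨
  2 * (4 * m) ^ j              ≤⟨ 2*[1+x]^j≤j!*2^[1+x+j] (m′ + 3 * m) j ⟩    -- 4 * m reduces to suc (m′ + 3 * m)
  j ! * 2 ^ (4 * m + j)        ≡⟨ cong (j ! *_) (^-distribˡ-+-* 2 (4 * m) j) ⟩
  j ! * (2 ^ (4 * m) * 2 ^ j)  ≡⟨ cong (λ z → j ! * (z * 2 ^ j)) (^-*-assoc 2 4 m) ⟨
  j ! * (16 ^ m * 2 ^ j)       ≡⟨ regroup′ (j !) (16 ^ m) (2 ^ j) ⟩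
  2 ^ j * (j ! * 16 ^ m)       ∎
  where
  open ≤-Reasoning
  regroup : ∀ P M → P * (2 * P * M) ≡ 2 * (P * P * M)
  regroup = solve-∀
  regroup′ : ∀ F X P → F * (X * P) ≡ P * (F * X)
  regroup′ = solve-∀

-- Σ_{j ≤ K} m^j/j! ≤ 16^m (1 − 2^−(K+1)), multiplied through by 2^(K+1) K!: by the term bound
-- above, the next term of the series fits into the slack 16^m 2^−(K+2).
partial-sums-bound : ∀ m .{{_ : NonZero m}} K →
                     2 ^ suc K * expScaled m K + K ! * 16 ^ m ≤ 2 ^ suc K * (K ! * 16 ^ m)
partial-sums-bound m@(suc _) zero = begin
  2 * 1 * 1 + 1 * 16 ^ m ≡⟨ normalise (16 ^ m) ⟩
  2 + 16 ^ m             ≤⟨ +-monoˡ-≤ (16 ^ m) 2≤16^m ⟩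
  16 ^ m + 16 ^ m        ≡⟨ normalise′ (16 ^ m) ⟩
  2 * 1 * (1 * 16 ^ m)   ∎
  where
  open ≤-Reasoning
  2≤16^m : 2 ≤ 16 ^ m
  2≤16^m = ≤-trans (s≤s (s≤s z≤n)) (^-monoʳ-≤ 16 {1} {m} (s≤s z≤n))
  normalise : ∀ X → 2 * 1 * 1 + 1 * X ≡ 2 + X
  normalise = solve-∀
  normalise′ : ∀ X → X + X ≡ 2 * 1 * (1 * X)
  normalise′ = solve-∀
partial-sums-bound m (suc K) = begin
  2 * P * (k * S + t) + k * F * X           ≡⟨ expand k P S t F X ⟩
  2 * k * (P * S) + (2 * P * t + k * F * X) ≤⟨ +-monoʳ-≤ (2 * k * (P * S))
                                                 (+-monoˡ-≤ (k * F * X) (2^[1+j]*m^j≤j!*16^m m k)) ⟩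
  2 * k * (P * S) + (k * F * X + k * F * X) ≡⟨ collect k P S F X ⟩
  2 * k * (P * S + F * X)                   ≤⟨ *-monoʳ-≤ (2 * k) (partial-sums-bound m K) ⟩
  2 * k * (P * (F * X))                     ≡⟨ regroup k P F X ⟩
  2 * P * (k * F * X)                       ∎
  where
  open ≤-Reasoning
  k P S t F X : ℕ
  k = suc K
  P = 2 ^ suc K
  S = expScaled m K
  t = m ^ suc K
  F = K !
  X = 16 ^ m
  expand : ∀ k P S t F X → 2 * P * (k * S + t) + k * F * X ≡ 2 * k * (P * S) + (2 * P * t + k * F * X)
  expand = solve-∀
  collect : ∀ k P S F X → 2 * k * (P * S) + (k * F * X + k * F * X) ≡ 2 * k * (P * S + F * X)
  collect = solve-∀
  regroup : ∀ k P F X → 2 * k * (P * (F * X)) ≡ 2 * P * (k * F * X)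
  regroup = solve-∀

ExpLe-monoʳ : ∀ {m x y} → ExpLe m x → x ≤ y → ExpLe m y
ExpLe-monoʳ e^m≤x x≤y K = ≤-trans (e^m≤x K) (*-monoʳ-≤ (K !) x≤y)

e^m≤16^m : ∀ m → ExpLe m (16 ^ m)
e^m≤16^m zero    zero    = ≤-refl
e^m≤16^m zero    (suc K) = begin
  suc K * expScaled 0 K + 0 ≡⟨ +-identityʳ _ ⟩
  suc K * expScaled 0 K     ≤⟨ *-monoʳ-≤ (suc K) (e^m≤16^m zero K) ⟩
  suc K * (K ! * 1)         ≡⟨ *-assoc (suc K) (K !) 1 ⟨
  suc K * K ! * 1           ∎
  where open ≤-Reasoning
e^m≤16^m m@(suc _) K =
  *-cancelˡ-≤ (2 ^ suc K) {{m^n≢0 2 (suc K)}} (≤-trans (m≤m+n _ _) (partial-sums-bound m K))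

16^[[1+L]*n]≤[2^L]^[8*n] : ∀ L n → 1 ≤ L → 16 ^ (suc L * n) ≤ (2 ^ L) ^ (8 * n)
16^[[1+L]*n]≤[2^L]^[8*n] L n 1≤L = begin
  16 ^ (suc L * n)         ≤⟨ ^-monoʳ-≤ 16 (*-monoˡ-≤ n (+-monoˡ-≤ L 1≤L)) ⟩
  16 ^ ((L + L) * n)       ≡⟨ ^-*-assoc 2 4 ((L + L) * n) ⟩
  2 ^ (4 * ((L + L) * n))  ≡⟨ cong (2 ^_) (regroup L n) ⟩
  2 ^ (L * (8 * n))        ≡⟨ ^-*-assoc 2 L (8 * n) ⟨
  (2 ^ L) ^ (8 * n)        ∎
  where
  open ≤-Reasoning
  regroup : ∀ L n → 4 * ((L + L) * n) ≡ L * (8 * n)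
  regroup = solve-∀

lemma3p6 : (k T : ℕ) → 2 ≤ k → 3 ≤ T →
    (a b : Fin k → ℕ) →
    (∀ i → 1 ≤ a i) → (∀ i → 1 ≤ b i) →
    (∀ i → toℕ i ≡ 0 → a i ≡ 1) →
    (∀ i → suc (toℕ i) ≡ k → b i ≡ 1) →
    (∀ i → a i * b i ≤ T) →
    SqrtLogBound (Delta a b) (Nsum a b) T
lemma3p6 k T _ 3≤T a b 1≤a 1≤b _ _ ab≤T = ExpLe-monoʳ (e^m≤16^m (Δ * Δ)) $ begin
  16 ^ (Δ * Δ)                ≤⟨ ^-monoʳ-≤ 16 (Delta²≤[1+⌊log₂T⌋]*4TN T a b 1≤a 1≤b ab≤T) ⟩
  16 ^ (suc L * (4 * T * N))  ≤⟨ 16^[[1+L]*n]≤[2^L]^[8*n] L (4 * T * N) 1≤L ⟩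
  (2 ^ L) ^ (8 * (4 * T * N)) ≤⟨ ^-monoˡ-≤ (8 * (4 * T * N)) (2^⌊log₂n⌋≤n T) ⟩
  T ^ (8 * (4 * T * N))       ≡⟨ cong (T ^_) (regroup T N) ⟩
  T ^ (32 * N * T)            ∎
  where
  open ≤-Reasoning
  instance
    T≢0 : NonZero T
    T≢0 = >-nonZero (≤-trans (s≤s z≤n) 3≤T)
  Δ N L : ℕ
  Δ = Delta a b
  N = Nsum a b
  L = ⌊log₂ T ⌋
  1≤L : 1 ≤ L
  1≤L = ⌊log₂⌋-mono-≤ (≤-trans (n≤1+n 2) 3≤T)
  regroup : ∀ T N → 8 * (4 * T * N) ≡ 32 * N * T
  regroup = solve-∀
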